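{- Let $x\geq 3$ be an odd integer. Then for all integers $c\geq 0$ and all $0\leq s\leq x-1$ there exists a standard linear realization of the list $\{1^{2x-2},x^s,(x+1)^c\}$.
   Context: The notation $\{1^{a_1},\ldots,t^{a_t}\}$ denotes the multiset with $a_i$ copies of $i$. For a list (multiset) $L$ of positive integers with $|L|$ elements, a linear realization of $L$ is an ordering $[x_0,\ldots,x_{|L|}]$ of $\{0,1,\ldots,|L|\}$ such that the multiset $\{|x_i-x_{i+1}|:0\le i\le |L|-1\}$ equals $L$; it is standard if $x_0=0$. -}

module Defs where

open import Data.Nat using (ℕ; zero; suc; _+_; _∸_; ∣_-_∣)
open import Data.List using (List; []; _∷_; length; upTo; replicate; _++_)
open import Data.List.Relation.Binary.Permutation.Propositional using (_↭_)
open import Data.Product using (_×_; ∃)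
open import Relation.Binary.PropositionalEquality using (_≡_)

diffs : List ℕ → List ℕ
diffs []           = []
diffs (a ∷ [])     = []
diffs (a ∷ b ∷ xs) = ∣ a - b ∣ ∷ diffs (b ∷ xs)

-- A linear realization of the list (multiset) L: an ordering xs of
-- {0,1,...,|L|} whose multiset of consecutive absolute differences equals L.
-- Multisets are lists up to permutation (_↭_).
LinearRealization : List ℕ → List ℕ → Set
LinearRealization L xs = (xs ↭ upTo (suc (length L))) × (diffs xs ↭ L)

StandardLinearRealization : List ℕ → List ℕ → Set
StandardLinearRealization L xs = LinearRealization L xs × ∃ (λ ys → xs ≡ 0 ∷ ys)

theList : ℕ → ℕ → ℕ → List ℕ
theList x s c = replicate (x + x ∸ 2) 1 ++ replicate s x ++ replicate c (suc x)

module Submission where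

-- Write x = X = 2j+3.  Realizations are built by repeated growth: if a path realizes D on
-- {0,…,N} and contains the edge {a,a+1}, inserting N+1, N+2 between a and a+1 yields a path
-- on {0,…,N+2} realizing D together with two copies of d = N+1-a (the difference 1 of the
-- broken edge reappears between N+1 and N+2).  With B = N-X, growing at a = B+1 adds two
-- differences X and growing at a = B adds two differences X+1.  To iterate, we track ladders
-- of edges {c,c+1}, c = B, B+2, …: the "even" ladder of (X+1)/2 rungs from B to B+X is
-- restored by every step, since X is odd and the new edge {N+1,N+2} is exactly its next rung;
-- the X-steps consume the rungs of an "odd" ladder from B+1, and a start supplies (X-1)/2 of
-- them, enough for s ≤ x-1.  Five explicit starting paths, each a few monotone runs, cover
-- the parities of s and c; from one of them, X-steps and then (X+1)-steps reach (s, c).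

open import Defs
open import Data.Nat using (ℕ; zero; suc; _+_; _*_; _∸_; _≤_; _%_; _/_; ∣_-_∣; z≤n; s≤s; s≤s⁻¹)
open import Data.Nat.Properties
  using ( +-suc; +-comm; +-assoc; +-identityʳ; ∣-∣-comm; ∣m-m+n∣≡n; suc-injective
        ; ≤-refl; ≤-trans; n≤1+n; m≤n+m; m≤n⇒m≤1+n; <⇒≢)
open import Data.Nat.DivMod using (m≡m%n+[m/n]*n)
open import Data.List using (List; []; _∷_; _++_; _∷ʳ_; [_]; length; replicate; upTo)
open import Data.List.Properties using (++-assoc; ++-identityʳ; applyUpTo-∷ʳ; length-upTo)
open import Data.List.Relation.Binary.Permutation.Propositional
  using (_↭_; ↭-refl; ↭-sym; ↭-trans; ↭-reflexive; ↭-prep; ↭-swap; module PermutationReasoning)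
open import Data.List.Relation.Binary.Permutation.Propositional.Properties
  using (shift; shifts; ++-comm; ++⁺ˡ; ++⁺ʳ; ↭-length)
open import Data.Product using (∃; ∃₂; Σ; _×_; _,_; proj₂)
open import Data.Sum using (_⊎_; inj₁; inj₂)
open import Data.Unit using (⊤; tt)
open import Data.Empty using (⊥-elim)
open import Function using (id; _∘_)
open import Relation.Binary.PropositionalEquality
  using (_≡_; _≢_; refl; sym; trans; cong; cong₂; subst; module ≡-Reasoning)

+-suc² : ∀ m n → m + suc (suc n) ≡ suc (suc (m + n))
+-suc² m n = trans (+-suc m (suc n)) (cong suc (+-suc m n))

dist : ∀ {a d b} → a + d ≡ b → ∣ a - b ∣ ≡ d
dist {a} {d} refl = ∣m-m+n∣≡n a d

dist′ : ∀ {a d b} → a + d ≡ b → ∣ b - a ∣ ≡ d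
dist′ {a} {b = b} a+d≡b = trans (∣-∣-comm b a) (dist a+d≡b)

data Adj (a b : ℕ) : List ℕ → Set where
  here  : ∀ {xs} → Adj a b (a ∷ b ∷ xs)
  there : ∀ {y xs} → Adj a b xs → Adj a b (y ∷ xs)

Edge : ℕ → ℕ → List ℕ → Set
Edge a b P = Adj a b P ⊎ Adj b a P

Edge-sym : ∀ {a b P} → Edge a b P → Edge b a P
Edge-sym (inj₁ h) = inj₂ h
Edge-sym (inj₂ h) = inj₁ h

Edge-map : ∀ {P Q} → (∀ {x y} → Adj x y P → Adj x y Q) → ∀ {a b} → Edge a b P → Edge a b Q
Edge-map f (inj₁ h) = inj₁ (f h)
Edge-map f (inj₂ h) = inj₂ (f h)

Adj-++ˡ : ∀ {a b xs} ys → Adj a b xs → Adj a b (xs ++ ys)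
Adj-++ˡ ys here      = here
Adj-++ˡ ys (there h) = there (Adj-++ˡ ys h)

Adj-++ʳ : ∀ {a b ys} xs → Adj a b ys → Adj a b (xs ++ ys)
Adj-++ʳ []       h = h
Adj-++ʳ (x ∷ xs) h = there (Adj-++ʳ xs h)

Adj-split : ∀ {a b P} → Adj a b P → ∃₂ λ pre post → P ≡ pre ++ a ∷ b ∷ post
Adj-split (here {xs})   = [] , xs , refl
Adj-split (there {y} h) with Adj-split h
... | pre , post , refl = y ∷ pre , post , refl

diffs-split : ∀ pre (a : ℕ) rest → diffs (pre ++ a ∷ rest) ≡ diffs (pre ++ [ a ]) ++ diffs (a ∷ rest)
diffs-split []            a rest = refl
diffs-split (y ∷ [])      a rest = refl
diffs-split (y ∷ x ∷ pre) a rest = cong (∣ y - x ∣ ∷_) (diffs-split (x ∷ pre) a rest)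

Adj-insert : ∀ (pre : List ℕ) {u v w z post a b} → Adj a b (pre ++ u ∷ v ∷ post) → a ≢ u ⊎ b ≢ v →
             Adj a b (pre ++ u ∷ w ∷ z ∷ v ∷ post)
Adj-insert []            here      (inj₁ a≢u) = ⊥-elim (a≢u refl)
Adj-insert []            here      (inj₂ b≢v) = ⊥-elim (b≢v refl)
Adj-insert []            (there h) _          = there (there (there h))
Adj-insert (y ∷ [])      here      _          = here
Adj-insert (y ∷ x ∷ pre) here      _          = here
Adj-insert (y ∷ pre)     (there h) ne         = there (Adj-insert pre h ne)

insert-start : ∀ (pre : List ℕ) {u v w z post x xs} → pre ++ u ∷ v ∷ post ≡ x ∷ xs →
               ∃ λ ys → pre ++ u ∷ w ∷ z ∷ v ∷ post ≡ x ∷ ys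
insert-start []        refl = _ , refl
insert-start (y ∷ pre) refl = _ , refl

record Insertion (u v w z : ℕ) (P : List ℕ) : Set where
  field
    result     : List ℕ
    vertices   : result ↭ w ∷ z ∷ P
    others     : List ℕ
    old-diffs  : diffs P ↭ ∣ u - v ∣ ∷ others
    new-diffs  : diffs result ↭ ∣ u - w ∣ ∷ ∣ w - z ∣ ∷ ∣ z - v ∣ ∷ others
    new-edge   : Edge w z result
    same-start : ∀ {x xs} → P ≡ x ∷ xs → ∃ λ ys → result ≡ x ∷ ys
    keeps      : ∀ {a b} → b ≢ u → b ≢ v → Edge a b P → Edge a b result

insertAt : ∀ pre u v w z post → Insertion u v w z (pre ++ u ∷ v ∷ post)
insertAt pre u v w z post = record
  { result     = pre ++ u ∷ w ∷ z ∷ v ∷ post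
  ; vertices   = begin
      pre ++ u ∷ w ∷ z ∷ v ∷ post          ≡⟨ sym (++-assoc pre [ u ] _) ⟩
      (pre ++ [ u ]) ++ w ∷ z ∷ v ∷ post   ↭⟨ shifts (pre ++ [ u ]) (w ∷ z ∷ []) ⟩
      w ∷ z ∷ (pre ++ [ u ]) ++ v ∷ post   ≡⟨ cong (λ l → w ∷ z ∷ l) (++-assoc pre [ u ] _) ⟩
      w ∷ z ∷ pre ++ u ∷ v ∷ post          ∎
  ; others     = before ++ after
  ; old-diffs  = begin
      diffs (pre ++ u ∷ v ∷ post)          ≡⟨ diffs-split pre u (v ∷ post) ⟩
      before ++ ∣ u - v ∣ ∷ after          ↭⟨ shift _ before after ⟩
      ∣ u - v ∣ ∷ before ++ after          ∎
  ; new-diffs  = begin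
      diffs (pre ++ u ∷ w ∷ z ∷ v ∷ post)  ≡⟨ diffs-split pre u (w ∷ z ∷ v ∷ post) ⟩
      before ++ ∣ u - w ∣ ∷ ∣ w - z ∣ ∷ ∣ z - v ∣ ∷ after
        ↭⟨ shifts before (∣ u - w ∣ ∷ ∣ w - z ∣ ∷ ∣ z - v ∣ ∷ []) ⟩
      ∣ u - w ∣ ∷ ∣ w - z ∣ ∷ ∣ z - v ∣ ∷ before ++ after ∎
  ; new-edge   = inj₁ (Adj-++ʳ pre (there here))
  ; same-start = insert-start pre
  ; keeps      = λ b≢u b≢v → λ where
      (inj₁ h) → inj₁ (Adj-insert pre h (inj₂ b≢v))
      (inj₂ h) → inj₂ (Adj-insert pre h (inj₁ b≢u))
  }
  where
  open PermutationReasoning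
  before = diffs (pre ++ [ u ])
  after  = diffs (v ∷ post)

reverse₃ : ∀ (a b c : ℕ) xs → a ∷ b ∷ c ∷ xs ↭ c ∷ b ∷ a ∷ xs
reverse₃ a b c xs = ↭-trans (↭-swap a b ↭-refl) (↭-trans (↭-prep b (↭-swap a c ↭-refl)) (↭-swap b c ↭-refl))

Insertion-flip : ∀ {u v w z P} → Insertion v u z w P → Insertion u v w z P
Insertion-flip {u} {v} {w} {z} I = record
  { result     = result
  ; vertices   = ↭-trans vertices (↭-swap z w ↭-refl)
  ; others     = others
  ; old-diffs  = subst (λ d → _ ↭ d ∷ others) (∣-∣-comm v u) old-diffs
  ; new-diffs  = ↭-trans new-diffs (↭-trans (reverse₃ _ _ _ others) (↭-reflexive
                   (cong₂ _∷_ (∣-∣-comm w u) (cong₂ _∷_ (∣-∣-comm z w) (cong (_∷ others) (∣-∣-comm v z))))))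
  ; new-edge   = Edge-sym new-edge
  ; same-start = same-start
  ; keeps      = λ b≢u b≢v → keeps b≢v b≢u
  }
  where open Insertion I

insert : ∀ {u v P} w z → Edge u v P → Insertion u v w z P
insert w z (inj₁ h) with Adj-split h
... | pre , post , refl = insertAt pre _ _ w z post
insert w z (inj₂ h) with Adj-split h
... | pre , post , refl = Insertion-flip (insertAt pre _ _ z w post)

Ladder : ℕ → ℕ → List ℕ → Set
Ladder a zero    P = ⊤
Ladder a (suc k) P = Edge a (suc a) P × Ladder (suc (suc a)) k P

Ladder-mono : ∀ {P Q} a k → (∀ {c} → a ≤ c → Edge c (suc c) P → Edge c (suc c) Q) →
              Ladder a k P → Ladder a k Q
Ladder-mono a zero    keep _       = tt
Ladder-mono a (suc k) keep (e , L) =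
  keep ≤-refl e , Ladder-mono (suc (suc a)) k (λ a+2≤c → keep (≤-trans (m≤n+m a 2) a+2≤c)) L

Ladder-map : ∀ {P Q} → (∀ {x y} → Adj x y P → Adj x y Q) → ∀ {a k} → Ladder a k P → Ladder a k Q
Ladder-map f {a} {k} = Ladder-mono a k (λ _ → Edge-map f)

Ladder-shorten : ∀ {a t k P} → t ≤ k → Ladder a k P → Ladder a t P
Ladder-shorten {t = zero}  _          _       = tt
Ladder-shorten {t = suc t} (s≤s t≤k) (e , L) = e , Ladder-shorten t≤k L

Ladder-snoc : ∀ a k {b P} → a + k * 2 ≡ b → Ladder a k P → Edge b (suc b) P → Ladder a (suc k) P
Ladder-snoc a zero    {P = P} a+0≡b _       e =
  subst (λ c → Edge c (suc c) P) (trans (sym a+0≡b) (+-identityʳ a)) e , tt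
Ladder-snoc a (suc k) a+2k≡b  (e′ , L) e = e′ , Ladder-snoc (suc (suc a)) k (trans (sym (+-suc² a _)) a+2k≡b) L e

record Realization (N : ℕ) (D P : List ℕ) : Set where
  field
    starts-at-0 : ∃ λ ys → P ≡ 0 ∷ ys
    vertices    : P ↭ upTo (suc N)
    differences : diffs P ↭ D

Realization-resp : ∀ {N D D′ P} → D ↭ D′ → Realization N D P → Realization N D′ P
Realization-resp D↭D′ R = record
  { starts-at-0 = starts-at-0 ; vertices = vertices ; differences = ↭-trans differences D↭D′ }
  where open Realization R

length-diffs : ∀ x xs → length (diffs (x ∷ xs)) ≡ length xs
length-diffs x []       = refl
length-diffs x (y ∷ xs) = cong suc (length-diffs y xs)

standard : ∀ {N D P} → Realization N D P → StandardLinearRealization D P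
standard {N} {D} {P} R with Realization.starts-at-0 R
... | ys , refl = (subst (λ n → P ↭ upTo (suc n)) N≡|D| vertices , differences) , ys , refl
  where
  open Realization R
  open ≡-Reasoning
  N≡|D| : N ≡ length D
  N≡|D| = begin
    N                      ≡⟨ suc-injective (sym (trans (↭-length vertices) (length-upTo (suc N)))) ⟩
    length ys              ≡⟨ sym (length-diffs 0 ys) ⟩
    length (diffs (0 ∷ ys)) ≡⟨ ↭-length differences ⟩
    length D               ∎

upTo-grow : ∀ n → upTo (suc (suc n)) ↭ n ∷ suc n ∷ upTo n
upTo-grow n = begin
  upTo (suc (suc n))        ≡⟨ sym (applyUpTo-∷ʳ id (suc n)) ⟩
  upTo (suc n) ∷ʳ suc n     ≡⟨ cong (_∷ʳ suc n) (sym (applyUpTo-∷ʳ id n)) ⟩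
  (upTo n ∷ʳ n) ∷ʳ suc n    ≡⟨ ++-assoc (upTo n) [ n ] [ suc n ] ⟩
  upTo n ++ n ∷ suc n ∷ []  ↭⟨ ++-comm (upTo n) (n ∷ suc n ∷ []) ⟩
  n ∷ suc n ∷ upTo n        ∎
  where open PermutationReasoning

-- Growing a realization on {0,…,N} by the vertices N+1, N+2, placed between consecutive
-- vertices a, a+1 with a + d = N + 1: one difference 1 becomes d, 1, d.
record Growth (N a d : ℕ) (D P : List ℕ) : Set where
  field
    path        : List ℕ
    realization : Realization (suc (suc N)) (d ∷ d ∷ D) path
    top-edge    : Edge (suc N) (suc (suc N)) path
    keeps       : ∀ {c k} → suc a ≤ c → Ladder c k P → Ladder c k path

grow : ∀ {N a d D P} → a + d ≡ suc N → Realization N D P → Edge a (suc a) P → Growth N a d D P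
grow {N} {a} {d} {D} {P} a+d≡ R e = record
  { path        = I.result
  ; realization = record
      { starts-at-0 = I.same-start (proj₂ R.starts-at-0)
      ; vertices    = ↭-trans I.vertices
                        (↭-trans (↭-prep _ (↭-prep _ R.vertices)) (↭-sym (upTo-grow (suc N))))
      ; differences = begin
          diffs I.result                  ↭⟨ I.new-diffs ⟩
          ∣ a - suc N ∣ ∷ ∣ N - suc N ∣ ∷ ∣ suc N - a ∣ ∷ I.others
            ≡⟨ cong₂ _∷_ (dist a+d≡) (cong₂ _∷_ (dist (+-comm N 1)) (cong (_∷ I.others) (dist′ a+d≡))) ⟩
          d ∷ 1 ∷ d ∷ I.others            ↭⟨ ↭-prep d (↭-swap 1 d ↭-refl) ⟩
          d ∷ d ∷ 1 ∷ I.others            ↭⟨ ↭-prep d (↭-prep d (↭-sym old-diffs)) ⟩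
          d ∷ d ∷ diffs P                 ↭⟨ ↭-prep d (↭-prep d R.differences) ⟩
          d ∷ d ∷ D                       ∎
      }
  ; top-edge    = I.new-edge
  ; keeps       = λ a<c → Ladder-mono _ _ λ {c′} c≤c′ →
      let a<c′ = ≤-trans a<c c≤c′ in
      I.keeps (λ eq → <⇒≢ (m≤n⇒m≤1+n a<c′) (sym eq)) (λ eq → <⇒≢ (s≤s a<c′) (sym eq))
  }
  where
  module R = Realization R
  module I = Insertion (insert (suc N) (suc (suc N)) e)
  open PermutationReasoning
  old-diffs : diffs P ↭ 1 ∷ I.others
  old-diffs = subst (λ δ → diffs P ↭ δ ∷ I.others) (dist (+-comm a 1)) I.old-diffs

run : ℕ → ℕ → List ℕ
run a zero    = []
run a (suc n) = a ∷ run (suc a) n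

down : ℕ → ℕ → List ℕ
down a zero    = []
down a (suc n) = a + n ∷ down a n

run-++ : ∀ a p n → run a p ++ run (a + p) n ≡ run a (p + n)
run-++ a zero    n = cong (λ b → run b n) (+-identityʳ a)
run-++ a (suc p) n = cong (a ∷_) (trans (cong (λ b → run (suc a) p ++ run b n) (+-suc a p)) (run-++ (suc a) p n))

run-join : ∀ a p {b} n → a + p ≡ b → run a p ++ run b n ≡ run a (p + n)
run-join a p n refl = run-++ a p n

run-snoc : ∀ a n → run a (suc n) ≡ run a n ∷ʳ (a + n)
run-snoc a n = trans (cong (run a) (+-comm 1 n)) (sym (run-++ a n 1))

upTo≡run : ∀ n → upTo n ≡ run 0 n
upTo≡run zero    = refl
upTo≡run (suc n) = trans (sym (applyUpTo-∷ʳ id n)) (trans (cong (_∷ʳ n) (upTo≡run n)) (sym (run-snoc 0 n)))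

intervals : ∀ p n {N} → p + n ≡ N → run 0 p ++ run p n ≡ upTo N
intervals p n {N} p+n≡N = trans (run-join 0 p n refl) (trans (cong (run 0) p+n≡N) (sym (upTo≡run N)))

down-snoc : ∀ a n → down a (suc n) ≡ down (suc a) n ++ [ a ]
down-snoc a zero    = cong [_] (+-identityʳ a)
down-snoc a (suc n) = cong₂ _∷_ (+-suc a n) (down-snoc a n)

down↭run : ∀ a n → down a n ↭ run a n
down↭run a zero    = ↭-refl
down↭run a (suc n) = begin
  down a (suc n)          ≡⟨ down-snoc a n ⟩
  down (suc a) n ++ [ a ] ↭⟨ ++-comm (down (suc a) n) [ a ] ⟩
  a ∷ down (suc a) n      ↭⟨ ↭-prep a (down↭run (suc a) n) ⟩
  a ∷ run (suc a) n       ∎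
  where open PermutationReasoning

diffs-run : ∀ a n ys → diffs (run a (suc n) ++ ys) ≡ replicate n 1 ++ diffs (a + n ∷ ys)
diffs-run a zero    ys = cong (λ b → diffs (b ∷ ys)) (sym (+-identityʳ a))
diffs-run a (suc n) ys = cong₂ _∷_ (dist (+-comm a 1))
  (trans (diffs-run (suc a) n ys) (cong (λ b → replicate n 1 ++ diffs (b ∷ ys)) (sym (+-suc a n))))

diffs-down : ∀ a n ys → diffs (down a (suc n) ++ ys) ≡ replicate n 1 ++ diffs (a ∷ ys)
diffs-down a zero    ys = cong (λ b → diffs (b ∷ ys)) (+-identityʳ a)
diffs-down a (suc n) ys = cong₂ _∷_ (dist′ (trans (+-comm (a + n) 1) (sym (+-suc a n)))) (diffs-down a n ys)

diffs-run-end : ∀ a n → diffs (run a (suc n)) ≡ replicate n 1 ++ []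
diffs-run-end a n = trans (cong diffs (sym (++-identityʳ (run a (suc n))))) (diffs-run a n [])

diffs-down-end : ∀ a n → diffs (down a (suc n)) ≡ replicate n 1 ++ []
diffs-down-end a n = trans (cong diffs (sym (++-identityʳ (down a (suc n))))) (diffs-down a n [])

replicate-++ : ∀ a b (x : ℕ) → replicate a x ++ replicate b x ≡ replicate (a + b) x
replicate-++ zero    b x = refl
replicate-++ (suc a) b x = cong (x ∷_) (replicate-++ a b x)

merge-ones : ∀ a b d ys → replicate a 1 ++ d ∷ replicate b 1 ++ ys ↭ replicate (a + b) 1 ++ d ∷ ys
merge-ones a b d ys = begin
  replicate a 1 ++ d ∷ replicate b 1 ++ ys      ↭⟨ ++⁺ˡ (replicate a 1) (↭-sym (shift d (replicate b 1) ys)) ⟩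
  replicate a 1 ++ replicate b 1 ++ d ∷ ys      ≡⟨ sym (++-assoc (replicate a 1) (replicate b 1) (d ∷ ys)) ⟩
  (replicate a 1 ++ replicate b 1) ++ d ∷ ys    ≡⟨ cong (_++ d ∷ ys) (replicate-++ a b 1) ⟩
  replicate (a + b) 1 ++ d ∷ ys                 ∎
  where open PermutationReasoning

Ladder-run : ∀ a k {n} → k * 2 ≤ n → Ladder a k (run a n)
Ladder-run a zero    _                 = tt
Ladder-run a (suc k) (s≤s (s≤s 2k≤n)) = inj₁ here , Ladder-map (there ∘ there) (Ladder-run (suc (suc a)) k 2k≤n)

Ladder-down : ∀ a k {n} → k * 2 ≤ n → Ladder a k (down a n)
Ladder-down a zero    _ = tt
Ladder-down a (suc k) {suc (suc n)} (s≤s (s≤s 2k≤n)) =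
  subst (Ladder a (suc k)) (sym bottom)
    (inj₂ (Adj-++ʳ (down (suc (suc a)) n) here) , Ladder-map (Adj-++ˡ _) (Ladder-down (suc (suc a)) k 2k≤n))
  where
  bottom : down a (suc (suc n)) ≡ down (suc (suc a)) n ++ suc a ∷ a ∷ []
  bottom = trans (down-snoc a (suc n))
             (trans (cong (_++ [ a ]) (down-snoc (suc a) n)) (++-assoc (down (suc (suc a)) n) [ suc a ] [ a ]))

Ladder-down-above : ∀ a k {n} → k * 2 ≤ n → Ladder (suc a) k (down a (suc n))
Ladder-down-above a k {n} 2k≤n =
  subst (Ladder (suc a) k) (sym (down-snoc a n)) (Ladder-map (Adj-++ˡ [ a ]) (Ladder-down (suc a) k 2k≤n))

data Parity : ℕ → Set where
  even : ∀ t → Parity (t * 2)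
  odd  : ∀ t → Parity (suc (t * 2))

parity : ∀ n → Parity n
parity zero    = even 0
parity (suc n) with parity n
... | even t = odd t
... | odd t  = even (suc t)

half : ∀ t k → t * 2 ≤ suc (k * 2) → t ≤ k
half zero    k       _                 = z≤n
half (suc t) zero    (s≤s ())
half (suc t) (suc k) (s≤s (s≤s 2t≤2k+1)) = s≤s (half t k 2t≤2k+1)

module Construction (j : ℕ) where

  X X-1 X-2 ones : ℕ
  X    = suc (suc (suc (j * 2)))
  X-1  = suc (suc (j * 2))
  X-2  = suc (j * 2)
  -- the number 2X-2 of differences 1 in the list; it is `X + X ∸ 2` by computation
  ones = X-2 + X

  theList-X : ∀ s c → theList X (suc (suc s)) c ↭ X ∷ X ∷ theList X s c
  theList-X s c = shifts (replicate ones 1) (X ∷ X ∷ [])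

  theList-X+1 : ∀ s c → theList X s (suc (suc c)) ↭ suc X ∷ suc X ∷ theList X s c
  theList-X+1 s c = begin
    replicate ones 1 ++ replicate s X ++ suc X ∷ suc X ∷ later
      ≡⟨ sym (++-assoc (replicate ones 1) (replicate s X) _) ⟩
    (replicate ones 1 ++ replicate s X) ++ suc X ∷ suc X ∷ later
      ↭⟨ shifts (replicate ones 1 ++ replicate s X) (suc X ∷ suc X ∷ []) ⟩
    suc X ∷ suc X ∷ (replicate ones 1 ++ replicate s X) ++ later
      ≡⟨ cong (λ l → suc X ∷ suc X ∷ l) (++-assoc (replicate ones 1) (replicate s X) later) ⟩
    suc X ∷ suc X ∷ theList X s c ∎
    where
    open PermutationReasoning
    later = replicate c (suc X)

  record Config (s c : ℕ) : Set where
    field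
      base        : ℕ
      path        : List ℕ
      realization : Realization (base + X) (theList X s c) path
  open Config

  -- The j+2 rungs {B,B+1}, …, {B+X-1,B+X} consumed one at a time by the (X+1)-steps.
  Even : ∀ {s c} → Config s c → Set
  Even cfg = Ladder (base cfg) (suc (suc j)) (path cfg)

  -- t rungs {B+1,B+2}, …, {B+2t-1,B+2t} for t further X-steps.
  Odd : ∀ {s c} → ℕ → Config s c → Set
  Odd t cfg = Ladder (suc (base cfg)) t (path cfg)

  recast : ∀ {s c s′ c′} → s ≡ s′ → c ≡ c′ → Config s c → Config s′ c′
  recast s≡s′ c≡c′ cfg = record
    { base        = base cfg
    ; path        = path cfg
    ; realization = Realization-resp (↭-reflexive (cong₂ (theList X) s≡s′ c≡c′)) (realization cfg)
    }

  top-up : ∀ {B P} → Ladder (suc (suc B)) (suc j) P → Edge (suc (B + X)) (suc (suc (B + X))) P →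
           Ladder (suc (suc B)) (suc (suc j)) P
  top-up {B} = Ladder-snoc _ (suc j) (sym (cong suc (+-suc B X-1)))

  step-X : ∀ {s c t} (cfg : Config s c) → Odd (suc t) cfg →
           Σ (Config (suc (suc s)) c) λ cfg′ → Odd t cfg′ × (Even cfg → Even cfg′)
  step-X {s} {c} cfg (e , odds) =
    cfg′ , G.keeps (n≤1+n _) odds , λ where (_ , evens) → top-up (G.keeps ≤-refl evens) G.top-edge
    where
    module G = Growth (grow {d = X} refl (realization cfg) e)
    cfg′ : Config (suc (suc s)) c
    cfg′ = record { base = suc (suc (base cfg)) ; path = G.path
                  ; realization = Realization-resp (↭-sym (theList-X s c)) G.realization }

  step-X+1 : ∀ {s c} (cfg : Config s c) → Even cfg → Σ (Config s (suc (suc c))) Even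
  step-X+1 {s} {c} cfg (e , evens) = cfg′ , top-up (G.keeps (n≤1+n _) evens) G.top-edge
    where
    module G = Growth (grow {d = suc X} (+-suc (base cfg) X) (realization cfg) e)
    cfg′ : Config s (suc (suc c))
    cfg′ = record { base = suc (suc (base cfg)) ; path = G.path
                  ; realization = Realization-resp (↭-sym (theList-X+1 s c)) G.realization }

  steps-X : ∀ t {s c} (cfg : Config s c) → Odd t cfg →
            Σ (Config (s + t * 2) c) λ cfg′ → Even cfg → Even cfg′
  steps-X zero    cfg _   = recast (sym (+-identityʳ _)) refl cfg , id
  steps-X (suc t) {s} cfg odds with step-X cfg odds
  ... | cfg₁ , odds₁ , evens₁ with steps-X t cfg₁ odds₁
  ... | cfg₂ , evens₂ = recast (sym (+-suc² s (t * 2))) refl cfg₂ , evens₂ ∘ evens₁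

  steps-X+1 : ∀ u {s c} (cfg : Config s c) → Even cfg → Σ (Config s (c + u * 2)) Even
  steps-X+1 zero    cfg evens = recast refl (sym (+-identityʳ _)) cfg , evens
  steps-X+1 (suc u) {c = c} cfg evens with step-X+1 cfg evens
  ... | cfg₁ , evens₁ with steps-X+1 u cfg₁ evens₁
  ... | cfg₂ , evens₂ = recast refl (sym (+-suc² c (u * 2))) cfg₂ , evens₂

  start-0-0 : Σ (Config 0 0) λ cfg → Odd (suc j) cfg × Even cfg
  start-0-0 = cfg , Ladder-map (Adj-++ʳ (run 0 X-2) ∘ there) (Ladder-run X-1 (suc j) (n≤1+n _))
                  , Ladder-map (Adj-++ʳ (run 0 X-2)) (Ladder-run X-2 (suc (suc j)) ≤-refl)
    where
    P = run 0 X-2 ++ run X-2 (suc X)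
    joined : P ≡ run 0 (suc ones)
    joined = trans (run-join 0 X-2 (suc X) refl) (cong (run 0) (+-suc X-2 X))
    cfg : Config 0 0
    cfg = record { base = X-2 ; path = P ; realization = record
      { starts-at-0 = _ , refl
      ; vertices    = ↭-reflexive (trans joined (sym (upTo≡run _)))
      ; differences = ↭-reflexive (trans (cong diffs joined) (diffs-run-end 0 ones))
      } }

  start-0-1 : Σ (Config 0 1) λ cfg → Odd (suc j) cfg × Even cfg
  start-0-1 = cfg , Ladder-map (Adj-++ʳ (run 0 X-1)) (Ladder-down-above X-1 (suc j) (n≤1+n _))
                  , Ladder-map (Adj-++ʳ (run 0 X-1)) (Ladder-down X-1 (suc (suc j)) ≤-refl)
    where
    open PermutationReasoning
    P = run 0 X-1 ++ down X-1 (suc X)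
    cfg : Config 0 1
    cfg = record { base = X-1 ; path = P ; realization = record
      { starts-at-0 = _ , refl
      ; vertices    = begin
          P                                 ↭⟨ ++⁺ˡ (run 0 X-1) (down↭run X-1 (suc X)) ⟩
          run 0 X-1 ++ run X-1 (suc X)      ≡⟨ intervals X-1 (suc X) (+-suc X-1 X) ⟩
          upTo (suc (X-1 + X))              ∎
      ; differences = begin
          diffs P                           ≡⟨ diffs-run 0 X-2 _ ⟩
          replicate X-2 1 ++ ∣ X-2 - X-1 + X ∣ ∷ diffs (down X-1 (suc X))
            ≡⟨ cong₂ (λ δ l → replicate X-2 1 ++ δ ∷ l) (dist {X-2} (+-suc X-2 X)) (diffs-down-end X-1 X) ⟩
          replicate X-2 1 ++ suc X ∷ replicate X 1 ++ []
            ↭⟨ merge-ones X-2 X (suc X) [] ⟩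
          theList X 0 1                     ∎
      } }

  start-1-0 : Σ (Config 1 0) (Odd j)
  start-1-0 = cfg , Ladder-map (Adj-++ʳ (run 0 X)) (Ladder-down X j (m≤n+m (j * 2) 3))
    where
    open PermutationReasoning
    P = run 0 X ++ down X X
    cfg : Config 1 0
    cfg = record { base = X-1 ; path = P ; realization = record
      { starts-at-0 = _ , refl
      ; vertices    = begin
          P                       ↭⟨ ++⁺ˡ (run 0 X) (down↭run X X) ⟩
          run 0 X ++ run X X      ≡⟨ intervals X X refl ⟩
          upTo (X + X)            ∎
      ; differences = begin
          diffs P                 ≡⟨ diffs-run 0 X-1 _ ⟩
          replicate X-1 1 ++ ∣ X-1 - X + X-1 ∣ ∷ diffs (down X X)
            ≡⟨ cong₂ (λ δ l → replicate X-1 1 ++ δ ∷ l) (dist {X-1} (+-comm X-1 X)) (diffs-down-end X X-1) ⟩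
          replicate X-1 1 ++ X ∷ replicate X-1 1 ++ []
            ↭⟨ merge-ones X-1 X-1 X [] ⟩
          replicate (X-1 + X-1) 1 ++ X ∷ []
            ≡⟨ cong (λ n → replicate n 1 ++ X ∷ []) (sym (cong suc (+-suc (j * 2) X-1))) ⟩
          theList X 1 0           ∎
      } }

  start-1-1 : Σ (Config 1 1) λ cfg → Odd j cfg × Even cfg
  start-1-1 = cfg , Ladder-map (there ∘ there ∘ Adj-++ˡ (down 1 X-1)) (Ladder-run (suc X) j (m≤n+m (j * 2) 3))
                  , Ladder-map (there ∘ Adj-++ˡ (down 1 X-1)) (Ladder-run X (suc (suc j)) ≤-refl)
    where
    open PermutationReasoning
    P = 0 ∷ run X (suc X) ++ down 1 X-1
    cfg : Config 1 1
    cfg = record { base = X ; path = P ; realization = record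
      { starts-at-0 = _ , refl
      ; vertices    = begin
          P                                ↭⟨ ↭-prep 0 (++-comm (run X (suc X)) (down 1 X-1)) ⟩
          0 ∷ down 1 X-1 ++ run X (suc X)  ↭⟨ ↭-prep 0 (++⁺ʳ (run X (suc X)) (down↭run 1 X-1)) ⟩
          run 0 X ++ run X (suc X)         ≡⟨ intervals X (suc X) (+-suc X X) ⟩
          upTo (suc (X + X))               ∎
      ; differences = begin
          diffs P                          ≡⟨ cong (X ∷_) (diffs-run X X _) ⟩
          X ∷ replicate X 1 ++ ∣ X + X - X-1 ∣ ∷ diffs (down 1 X-1)
            ≡⟨ cong₂ (λ δ l → X ∷ replicate X 1 ++ δ ∷ l) (dist′ {X-1} (+-suc X-1 X)) (diffs-down-end 1 X-2) ⟩
          X ∷ replicate X 1 ++ suc X ∷ replicate X-2 1 ++ []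
            ↭⟨ ↭-prep X (merge-ones X X-2 (suc X) []) ⟩
          X ∷ replicate (X + X-2) 1 ++ suc X ∷ []
            ↭⟨ ↭-sym (shift X (replicate (X + X-2) 1) (suc X ∷ [])) ⟩
          replicate (X + X-2) 1 ++ X ∷ suc X ∷ []
            ≡⟨ cong (λ n → replicate n 1 ++ X ∷ suc X ∷ []) (+-comm X X-2) ⟩
          theList X 1 1                    ∎
      } }

  tail-1-2 path-1-2 : List ℕ
  tail-1-2 = suc (X + X) ∷ X + X ∷ X-1 ∷ X ∷ []
  path-1-2 = run 0 X-1 ++ down (suc X) X-1 ++ tail-1-2

  vertices-1-2 : path-1-2 ↭ upTo (suc (suc X + X))
  vertices-1-2 = begin
    path-1-2                           ↭⟨ ++⁺ˡ (run 0 X-1) (++⁺ʳ tail-1-2 (down↭run (suc X) X-1)) ⟩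
    run 0 X-1 ++ run (suc X) X-1 ++ tail-1-2
      ↭⟨ ++⁺ˡ (run 0 X-1) (↭-trans (++⁺ˡ (run (suc X) X-1) tail↭) (shifts (run (suc X) X-1) (run X-1 2))) ⟩
    run 0 X-1 ++ run X-1 2 ++ run (suc X) X-1 ++ run (X + X) 2
      ≡⟨ cong (λ l → run 0 X-1 ++ run X-1 2 ++ l) (run-join (suc X) X-1 2 (sym (+-suc X X-1))) ⟩
    run 0 X-1 ++ run X-1 (2 + (X-1 + 2))
      ≡⟨ intervals X-1 _ length-1-2 ⟩
    upTo (suc (suc X + X))             ∎
    where
    open PermutationReasoning
    tail↭ : tail-1-2 ↭ run X-1 2 ++ run (X + X) 2
    tail↭ = ↭-trans (shifts (suc (X + X) ∷ X + X ∷ []) (X-1 ∷ X ∷ []))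
                    (↭-prep X-1 (↭-prep X (↭-swap (suc (X + X)) (X + X) ↭-refl)))
    length-1-2 : X-1 + suc (suc (X-1 + 2)) ≡ suc (suc X + X)
    length-1-2 = trans (+-suc² X-1 _) (cong (suc ∘ suc) (trans (cong (X-1 +_) (+-comm X-1 2)) (+-suc X-1 X)))

  differences-1-2 : diffs path-1-2 ↭ theList X 1 2
  differences-1-2 = begin
    diffs path-1-2                     ≡⟨ diffs-run 0 X-2 _ ⟩
    replicate X-2 1 ++ ∣ X-2 - suc X + X-2 ∣ ∷ diffs (down (suc X) X-1 ++ tail-1-2)
      ≡⟨ cong₂ (λ δ l → replicate X-2 1 ++ δ ∷ l) (dist {X-2} (+-comm X-2 (suc X))) (diffs-down (suc X) X-2 tail-1-2) ⟩
    replicate X-2 1 ++ suc X ∷ replicate X-2 1 ++ diffs (suc X ∷ tail-1-2)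
      ≡⟨ cong (λ l → replicate X-2 1 ++ suc X ∷ replicate X-2 1 ++ l) tail-diffs ⟩
    replicate X-2 1 ++ suc X ∷ replicate X-2 1 ++ X ∷ 1 ∷ suc X ∷ 1 ∷ []
      ↭⟨ merge-ones X-2 X-2 (suc X) _ ⟩
    replicate (X-2 + X-2) 1 ++ suc X ∷ X ∷ 1 ∷ suc X ∷ 1 ∷ []
      ↭⟨ ++⁺ˡ (replicate (X-2 + X-2) 1) ones-first ⟩
    replicate (X-2 + X-2) 1 ++ replicate 2 1 ++ X ∷ suc X ∷ suc X ∷ []
      ≡⟨ sym (++-assoc (replicate (X-2 + X-2) 1) (replicate 2 1) _) ⟩
    (replicate (X-2 + X-2) 1 ++ replicate 2 1) ++ X ∷ suc X ∷ suc X ∷ []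
      ≡⟨ cong (_++ X ∷ suc X ∷ suc X ∷ []) (trans (replicate-++ (X-2 + X-2) 2 1) (cong (λ n → replicate n 1) count)) ⟩
    theList X 1 2                      ∎
    where
    open PermutationReasoning
    tail-diffs : diffs (suc X ∷ tail-1-2) ≡ X ∷ 1 ∷ suc X ∷ 1 ∷ []
    tail-diffs = cong₂ _∷_ (dist {X} refl) (cong₂ _∷_ (dist′ {X + X} (+-comm (X + X) 1))
                   (cong₂ _∷_ (dist′ {X-1} (+-suc X-1 X)) (cong (_∷ []) (dist {X-1} (+-comm X-1 1)))))
    ones-first : suc X ∷ X ∷ 1 ∷ suc X ∷ 1 ∷ [] ↭ 1 ∷ 1 ∷ X ∷ suc X ∷ suc X ∷ []
    ones-first = ↭-trans (shift 1 (suc X ∷ X ∷ []) (suc X ∷ 1 ∷ []))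
                   (↭-prep 1 (↭-trans (shift 1 (suc X ∷ X ∷ suc X ∷ []) [])
                                      (↭-prep 1 (↭-swap (suc X) X ↭-refl))))
    count : X-2 + X-2 + 2 ≡ ones
    count = trans (+-assoc X-2 X-2 2) (cong (X-2 +_) (+-comm X-2 2))

  -- Its even ladder runs through the decreasing run and ends with the rung {2X,2X+1} of the tail.
  start-1-2 : Σ (Config 1 2) λ cfg → Odd j cfg × Even cfg
  start-1-2 = cfg , Ladder-map inner (Ladder-down-above (suc X) j (n≤1+n _))
                  , Ladder-snoc (suc X) (suc j) (sym (+-suc X X-1))
                      (Ladder-map inner (Ladder-down (suc X) (suc j) ≤-refl))
                      (inj₂ (Adj-++ʳ (run 0 X-1) (Adj-++ʳ (down (suc X) X-1) here)))
    where
    inner : ∀ {a b} → Adj a b (down (suc X) X-1) → Adj a b path-1-2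
    inner = Adj-++ʳ (run 0 X-1) ∘ Adj-++ˡ tail-1-2
    cfg : Config 1 2
    cfg = record { base = suc X ; path = path-1-2 ; realization = record
      { starts-at-0 = _ , refl ; vertices = vertices-1-2 ; differences = differences-1-2 } }

  complete : ∀ {s c k} t u → t ≤ k → (Σ (Config s c) λ cfg → Odd k cfg × Even cfg) →
             ∃ λ P → StandardLinearRealization (theList X (s + t * 2) (c + u * 2)) P
  complete t u t≤k (cfg , odds , evens) =
    let cfg₁ , evens₁ = steps-X t cfg (Ladder-shorten t≤k odds)
        cfg₂ , _      = steps-X+1 u cfg₁ (evens₁ evens)
    in path cfg₂ , standard (realization cfg₂)

  realize : ∀ s c → s ≤ X-1 → ∃ λ P → StandardLinearRealization (theList X s c) P
  realize s c s≤X-1 with parity s | parity c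
  ... | even t | even u       = complete t u (half t (suc j) (m≤n⇒m≤1+n s≤X-1)) start-0-0
  ... | even t | odd u        = complete t u (half t (suc j) (m≤n⇒m≤1+n s≤X-1)) start-0-1
  ... | odd t  | odd u        = complete t u (half t j (s≤s⁻¹ s≤X-1)) start-1-1
  ... | odd t  | even (suc u) = complete t u (half t j (s≤s⁻¹ s≤X-1)) start-1-2
  ... | odd t  | even zero    =
    let cfg , odds = start-1-0
        cfg₁ , _   = steps-X t cfg (Ladder-shorten (half t j (s≤s⁻¹ s≤X-1)) odds)
    in path cfg₁ , standard (realization cfg₁)

odd-form : ∀ {x} h → x ≡ 1 + h * 2 → 3 ≤ x → ∃ λ j → x ≡ suc (suc (suc (j * 2)))
odd-form zero    refl (s≤s ())
odd-form (suc j) refl _ = j , refl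

proposition3p8 : (x : ℕ) → 3 ≤ x → x % 2 ≡ 1 → (c s : ℕ) → s ≤ x ∸ 1 →
    ∃ (λ (xs : List ℕ) → StandardLinearRealization (theList x s c) xs)
proposition3p8 x 3≤x x%2≡1 c s s≤x∸1
  with odd-form (x / 2) (trans (m≡m%n+[m/n]*n x 2) (cong (_+ x / 2 * 2) x%2≡1)) 3≤x
... | j , refl = Construction.realize j s c s≤x∸1
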